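{- If $G$ is a $2$-connected chordal graph, then $d_\Delta(G)=\max\{2,\alpha(G)\}$.
   Context: All graphs are finite, simple, undirected and connected. A graph is chordal if every cycle on four or more vertices has a chord. $\alpha(G)$ is the independence number. For $S\subseteq V(G)$, the $\Delta$-interval $[S]$ is the set consisting of all vertices of $S$ together with every vertex $v$ adjacent to both $x$ and $y$ for some pair of adjacent vertices $x,y\in S$. A set $S$ is $\Delta$-convex if $[S]=S$, and $\langle S\rangle$ denotes the smallest $\Delta$-convex set containing $S$ ($\langle\emptyset\rangle=\emptyset$). A set $S$ is convexly independent if $a\notin\langle S\setminus\{a\}\rangle$ for every $a\in S$. The rank $d_\Delta(G)$ is the least integer $n\ge0$ such that every $S\subseteq V(G)$ with $|S|>n$ is not convexly independent (equivalently, the maximum size of a convexly independent set). -}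

module Defs where

open import Data.Nat using (ℕ; zero; suc; _+_; _∸_; _≤_; _<_; _>_)
open import Data.Fin using (Fin; toℕ)
open import Data.Fin.Subset using (Subset; _∈_; _⊆_; _-_; ∣_∣)
open import Data.Product using (Σ; ∃; ∃-syntax; _×_; _,_)
open import Data.Sum using (_⊎_)
open import Data.Unit using (⊤)
open import Relation.Nullary using (¬_)
open import Relation.Binary.PropositionalEquality using (_≡_; _≢_)

record Graph (n : ℕ) : Set₁ where
  field
    Adj    : Fin n → Fin n → Set
    sym    : ∀ {u v} → Adj u v → Adj v u
    irrefl : ∀ {u} → ¬ Adj u u
open Graph public

module _ {n : ℕ} (G : Graph n) where

  -- u reaches v by a walk all of whose vertices after u satisfy P.
  data Reach (P : Fin n → Set) : Fin n → Fin n → Set where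
    here : ∀ {u} → Reach P u u
    step : ∀ {u v w} → Adj G u v → P v → Reach P v w → Reach P u w

  Connected : Set
  Connected = ∀ u v → Reach (λ _ → ⊤) u v

  TwoConnected : Set
  TwoConnected = (3 ≤ n) × Connected ×
    (∀ w u v → u ≢ w → v ≢ w → Reach (λ x → x ≢ w) u v)

  record Cycle (k : ℕ) : Set where
    field
      vtx    : ℕ → Fin n
      len≥4  : 4 ≤ k
      inj    : ∀ i j → i < k → j < k → vtx i ≡ vtx j → i ≡ j
      edges  : ∀ i → suc i < k → Adj G (vtx i) (vtx (suc i))
      closes : Adj G (vtx (k ∸ 1)) (vtx 0)

  -- A chord: an edge between two vertices not consecutive on the cycle.
  HasChord : ∀ {k} → Cycle k → Set
  HasChord {k} C = ∃[ i ] ∃[ j ] (suc i < j × j < k × ¬ (i ≡ 0 × j ≡ k ∸ 1)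
                     × Adj G (Cycle.vtx C i) (Cycle.vtx C j))

  Chordal : Set
  Chordal = ∀ k (C : Cycle k) → HasChord C

  Independent : Subset n → Set
  Independent S = ∀ x y → x ∈ S → y ∈ S → ¬ Adj G x y

  IsIndependenceNumber : ℕ → Set
  IsIndependenceNumber a =
    (∃[ S ] (Independent S × ∣ S ∣ ≡ a)) × (∀ S → Independent S → ∣ S ∣ ≤ a)

  InInterval : Subset n → Fin n → Set
  InInterval S v = v ∈ S ⊎
    (∃[ x ] ∃[ y ] (x ∈ S × y ∈ S × Adj G x y × Adj G v x × Adj G v y))

  ΔConvex : Subset n → Set
  ΔConvex S = ∀ v → InInterval S v → v ∈ S

  InHull : Subset n → Fin n → Set
  InHull S v = ∀ T → S ⊆ T → ΔConvex T → v ∈ T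

  ConvexlyIndependent : Subset n → Set
  ConvexlyIndependent S = ∀ a → a ∈ S → ¬ InHull (S - a) a

  IsRank : ℕ → Set
  IsRank d =
    (∀ S → ∣ S ∣ > d → ¬ ConvexlyIndependent S) ×
    (∀ m → (∀ S → ∣ S ∣ > m → ¬ ConvexlyIndependent S) → d ≤ m)

-- Let T be Δ-convex, a, b ∈ T adjacent and w a neighbour of a. By
-- 2-connectivity some path from w to b avoids a; closed up through a it is a
-- cycle whose closing edge ab lies in T. In a chordal graph such a cycle lies
-- entirely in T, by induction on its length: a triangle is absorbed by
-- Δ-convexity, and a longer cycle is split along a chord. So T contains every
-- neighbour of a, and by connectivity T = V(G) as soon as T contains an edge.
--
-- Hence a convexly independent set S with at least three vertices is
-- independent: if x, y ∈ S were adjacent, every Δ-convex set containing S minus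
-- a third vertex z would contain the edge xy and so z. Conversely, removing a
-- vertex from an independent set or from a pair leaves a set without edges,
-- which is Δ-convex, so those sets are convexly independent.

module Submission where

open import Defs
open import Data.Nat using (ℕ; zero; suc; _+_; _∸_; _⊔_; _≤_; _<_; z≤n; s≤s; _≤?_)
open import Data.Nat.Properties hiding (_≟_)
open import Data.Nat.Properties using () renaming (_≟_ to _≟ℕ_)
open import Data.Nat.Induction using (<-rec)
open import Data.Fin using (Fin; _≟_)
open import Data.Fin.Subset
  using (Subset; inside; outside; _∈_; _∉_; _─_; _-_; ⁅_⁆; ∣_∣)
  renaming (⊥ to ∅)
open import Data.Fin.Subset.Properties
  using (∉⊥; x∈⁅x⁆; ∣⁅x⁆∣≡1; ∣⊥∣≡0; p─q⊆p; x∈p∧x≢y⇒x∈p-y; nonempty?; Empty-unique)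
open import Data.Vec using ([]; _∷_; here; there)
open import Data.List using (List; []; _∷_; length)
open import Data.List.Membership.Propositional using () renaming (_∈_ to _∈ₗ_)
open import Data.List.Relation.Unary.All using (All; []; _∷_)
import Data.List.Relation.Unary.All as All
open import Data.List.Relation.Unary.All.Properties using (¬Any⇒All¬)
open import Data.List.Relation.Unary.Any using (here; there)
open import Data.List.Relation.Unary.Unique.Propositional using (Unique)
open import Data.List.Relation.Unary.AllPairs using ([]; _∷_)
open import Data.Product using (Σ-syntax; ∃-syntax; _×_; _,_; proj₁; proj₂)
open import Data.Sum using (inj₁; inj₂)
open import Function using (_∘_)
open import Data.Empty using (⊥-elim)
open import Relation.Nullary using (¬_; yes; no; contradiction)
open import Relation.Binary.PropositionalEquality using (_≡_; _≢_; refl; cong; subst; subst₂; ≢-sym)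
import Relation.Binary.PropositionalEquality as ≡

private
  variable
    n : ℕ

x∈p─q⇒x∉q : {p q : Subset n} {x : Fin n} → x ∈ p ─ q → x ∉ q
x∈p─q⇒x∉q {p = _ ∷ _} {outside ∷ _} here       ()
x∈p─q⇒x∉q {p = _ ∷ _} {_ ∷ _}       (there x∈) (there x∈q) = x∈p─q⇒x∉q x∈ x∈q

x∈p-y⇒x≢y : {p : Subset n} {x y : Fin n} → x ∈ p - y → x ≢ y
x∈p-y⇒x≢y {y = y} x∈ refl = x∈p─q⇒x∉q x∈ (x∈⁅x⁆ y)

∣p∣≤∣p─q∣+∣q∣ : (p q : Subset n) → ∣ p ∣ ≤ ∣ p ─ q ∣ + ∣ q ∣
∣p∣≤∣p─q∣+∣q∣ []             []              = z≤n
∣p∣≤∣p─q∣+∣q∣ (inside ∷ p)  (inside ∷ q)   =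
  subst (suc ∣ p ∣ ≤_) (≡.sym (+-suc ∣ p ─ q ∣ ∣ q ∣)) (s≤s (∣p∣≤∣p─q∣+∣q∣ p q))
∣p∣≤∣p─q∣+∣q∣ (inside ∷ p)  (outside ∷ q)  = s≤s (∣p∣≤∣p─q∣+∣q∣ p q)
∣p∣≤∣p─q∣+∣q∣ (outside ∷ p) (inside ∷ q)   =
  ≤-trans (∣p∣≤∣p─q∣+∣q∣ p q) (+-monoʳ-≤ ∣ p ─ q ∣ (n≤1+n ∣ q ∣))
∣p∣≤∣p─q∣+∣q∣ (outside ∷ p) (outside ∷ q)  = ∣p∣≤∣p─q∣+∣q∣ p q

∣p∣≤1+∣p-x∣ : (p : Subset n) (x : Fin n) → ∣ p ∣ ≤ suc ∣ p - x ∣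
∣p∣≤1+∣p-x∣ p x = subst (∣ p ∣ ≤_) eq (∣p∣≤∣p─q∣+∣q∣ p ⁅ x ⁆)
  where
  eq : ∣ p - x ∣ + ∣ ⁅ x ⁆ ∣ ≡ suc ∣ p - x ∣
  eq = ≡.trans (cong (∣ p - x ∣ +_) (∣⁅x⁆∣≡1 x)) (+-comm ∣ p - x ∣ 1)

∃-third : (p : Subset n) (x y : Fin n) → 3 ≤ ∣ p ∣ → ∃[ z ] (z ∈ p × z ≢ x × z ≢ y)
∃-third {n} p x y 3≤∣p∣ with nonempty? (p - x - y)
... | yes (z , z∈) = z , p─q⊆p p ⁅ x ⁆ z∈p-x , x∈p-y⇒x≢y z∈p-x , x∈p-y⇒x≢y z∈
  where
  z∈p-x : z ∈ p - x
  z∈p-x = p─q⊆p (p - x) ⁅ y ⁆ z∈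
... | no ∄z = contradiction 3≤∣p∣ (<⇒≱ (s≤s ∣p∣≤2))
  where
  ∣p-x-y∣≡0 : ∣ p - x - y ∣ ≡ 0
  ∣p-x-y∣≡0 = ≡.trans (cong ∣_∣ (Empty-unique ∄z)) (∣⊥∣≡0 n)
  ∣p∣≤2 : ∣ p ∣ ≤ 2
  ∣p∣≤2 = ≤-trans (∣p∣≤1+∣p-x∣ p x)
            (s≤s (subst (λ m → ∣ p - x ∣ ≤ suc m) ∣p-x-y∣≡0 (∣p∣≤1+∣p-x∣ (p - x) y)))

-- Loop-erased walks

module _ {G : Graph n} {P : Fin n → Set} where

  open import Data.List.Membership.DecPropositional (_≟_ {n}) using () renaming (_∈?_ to _∈ₗ?_)

  vertices : {u v : Fin n} → Reach G P u v → List (Fin n)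
  vertices here                 = []
  vertices (step {v = v} _ _ r) = v ∷ vertices r

  vertices-All : {u v : Fin n} (r : Reach G P u v) → All P (vertices r)
  vertices-All here         = []
  vertices-All (step _ p r) = p ∷ vertices-All r

  vertex : {u v : Fin n} → Reach G P u v → ℕ → Fin n
  vertex {u} _            zero    = u
  vertex {u} here         (suc _) = u
  vertex     (step _ _ r) (suc k) = vertex r k

  vertex-last : {u v : Fin n} (r : Reach G P u v) → vertex r (length (vertices r)) ≡ v
  vertex-last here         = refl
  vertex-last (step _ _ r) = vertex-last r

  vertex-adj : {u v : Fin n} (r : Reach G P u v) {k : ℕ} →
               k < length (vertices r) → Adj G (vertex r k) (vertex r (suc k))
  vertex-adj (step uv _ _) {zero}  _        = uv
  vertex-adj (step _ _ r)  {suc k} (s≤s k<) = vertex-adj r k<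

  vertex-∈ : {u v : Fin n} (r : Reach G P u v) {k : ℕ} →
             k ≤ length (vertices r) → vertex r k ∈ₗ u ∷ vertices r
  vertex-∈ _            {zero}  _        = here refl
  vertex-∈ (step _ _ r) {suc k} (s≤s k≤) = there (vertex-∈ r k≤)

  vertex-injective : {u v : Fin n} (r : Reach G P u v) → Unique (u ∷ vertices r) →
                     {k l : ℕ} → k ≤ length (vertices r) → l ≤ length (vertices r) →
                     vertex r k ≡ vertex r l → k ≡ l
  vertex-injective _ _ {zero} {zero} _ _ _ = refl
  vertex-injective (step _ _ r) (u∉ ∷ _) {zero} {suc l} _ (s≤s l≤) eq =
    ⊥-elim (All.lookup u∉ (vertex-∈ r l≤) eq)
  vertex-injective (step _ _ r) (u∉ ∷ _) {suc k} {zero} (s≤s k≤) _ eq =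
    ⊥-elim (All.lookup u∉ (vertex-∈ r k≤) (≡.sym eq))
  vertex-injective (step _ _ r) (_ ∷ U) {suc k} {suc l} (s≤s k≤) (s≤s l≤) eq =
    cong suc (vertex-injective r U k≤ l≤ eq)

  suffixFrom : {u v w : Fin n} (r : Reach G P v w) → Unique (v ∷ vertices r) →
               u ∈ₗ v ∷ vertices r → Σ[ s ∈ Reach G P u w ] Unique (u ∷ vertices s)
  suffixFrom r            U       (here refl) = r , U
  suffixFrom (step _ _ r) (_ ∷ U) (there u∈)  = suffixFrom r U u∈

  loopErase : {u v : Fin n} → Reach G P u v → Σ[ s ∈ Reach G P u v ] Unique (u ∷ vertices s)
  loopErase here = here , [] ∷ []
  loopErase {u} (step uv p r) with loopErase r
  ... | s , U with u ∈ₗ? vertices (step uv p s)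
  ...   | yes u∈ = suffixFrom s U u∈
  ...   | no u∉  = step uv p s , ¬Any⇒All¬ _ u∉ ∷ U

module _ (G : Graph n) where

  record Cycle′ (L : ℕ) : Set where
    field
      vtx    : ℕ → Fin n
      inj    : ∀ i j → i < L → j < L → vtx i ≡ vtx j → i ≡ j
      edges  : ∀ i → suc i < L → Adj G (vtx i) (vtx (suc i))
      closes : Adj G (vtx (L ∸ 1)) (vtx 0)

  toCycle : {L : ℕ} → 4 ≤ L → Cycle′ L → Cycle G L
  toCycle 4≤L C = record { vtx = vtx ; len≥4 = 4≤L ; inj = inj ; edges = edges ; closes = closes }
    where open Cycle′ C

  reach⇒cycle : {P : Fin n → Set} {u v : Fin n} (r : Reach G P u v) →
                Unique (u ∷ vertices r) → Adj G v u → Cycle′ (suc (length (vertices r)))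
  reach⇒cycle r U vu = record
    { vtx    = vertex r
    ; inj    = λ i j i< j< → vertex-injective r U (≤-pred i<) (≤-pred j<)
    ; edges  = λ i i< → vertex-adj r (≤-pred i<)
    ; closes = subst (λ z → Adj G z (vertex r 0)) (≡.sym (vertex-last r)) vu
    }

  subcycle : {L L′ : ℕ} (C : Cycle′ L) (f : ℕ → ℕ) → let open Cycle′ C in
             (∀ {k} → k < L′ → f k < L) → (∀ {k l} → f k ≡ f l → k ≡ l) →
             (∀ {k} → suc k < L′ → Adj G (vtx (f k)) (vtx (f (suc k)))) →
             Adj G (vtx (f (L′ ∸ 1))) (vtx (f 0)) → Cycle′ L′
  subcycle C f f< f-inj f-edges f-closes = record
    { vtx    = λ k → vtx (f k)
    ; inj    = λ k l k< l< eq → f-inj (inj (f k) (f l) (f< k<) (f< l<) eq)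
    ; edges  = λ k k< → f-edges k<
    ; closes = f-closes
    }
    where open Cycle′ C

-- Splitting a cycle along a chord

m+[2+n]≡2+m+n : ∀ m n → m + suc (suc n) ≡ suc (suc (m + n))
m+[2+n]≡2+m+n m n = ≡.trans (+-suc m (suc n)) (cong suc (+-suc m n))

-- skip i e k is k for k ≤ i and k + 1 + e otherwise: it enumerates the
-- indices outside the interval [i + 1, i + 1 + e].
skip : ℕ → ℕ → ℕ → ℕ
skip _       _ zero    = zero
skip zero    e (suc k) = suc (suc (e + k))
skip (suc i) e (suc k) = suc (skip i e k)

skip-≤ : ∀ {i e k} → k ≤ i → skip i e k ≡ k
skip-≤ {_}     {_} {zero}  _         = refl
skip-≤ {suc i} {_} {suc k} (s≤s k≤i) = cong suc (skip-≤ k≤i)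

skip-after : ∀ i e t → skip i e (suc (i + t)) ≡ 2 + i + e + t
skip-after zero    e t = refl
skip-after (suc i) e t = cong suc (skip-after i e t)

skip-jump : ∀ i e → skip i e (suc i) ≡ 2 + i + e
skip-jump zero    e = cong (2 +_) (+-identityʳ e)
skip-jump (suc i) e = cong suc (skip-jump i e)

skip-suc : ∀ {i e k} → k ≢ i → skip i e (suc k) ≡ suc (skip i e k)
skip-suc {zero}  {_} {zero}  k≢i = ⊥-elim (k≢i refl)
skip-suc {suc i} {_} {zero}  _   = refl
skip-suc {zero}  {e} {suc k} _   = cong (2 +_) (+-suc e k)
skip-suc {suc i} {_} {suc k} k≢i = cong suc (skip-suc (k≢i ∘ cong suc))

skip-injective : ∀ {i e k l} → skip i e k ≡ skip i e l → k ≡ l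
skip-injective {_}     {_} {zero}  {zero}  _  = refl
skip-injective {zero}  {_} {zero}  {suc l} ()
skip-injective {suc i} {_} {zero}  {suc l} ()
skip-injective {zero}  {_} {suc k} {zero}  ()
skip-injective {suc i} {_} {suc k} {zero}  ()
skip-injective {zero}  {e} {suc k} {suc l} eq =
  cong suc (+-cancelˡ-≡ e k l (suc-injective (suc-injective eq)))
skip-injective {suc i} {_} {suc k} {suc l} eq = cong suc (skip-injective (suc-injective eq))

skip-< : ∀ i e r {k} → k < 2 + i + r → skip i e k < 3 + i + e + r
skip-< _       _ _ {zero}  _        = s≤s z≤n
skip-< zero    e r {suc k} (s≤s k<) = s≤s (s≤s (s≤s (+-monoʳ-≤ e (≤-pred k<))))
skip-< (suc i) e r {suc k} (s≤s k<) = s≤s (skip-< i e r k<)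

3+e<3+i+e+r : ∀ i e r → ¬ (i ≡ 0 × r ≡ 0) → 3 + e < 3 + i + e + r
3+e<3+i+e+r zero    e zero    ¬both0 = ⊥-elim (¬both0 (refl , refl))
3+e<3+i+e+r zero    e (suc r) _  =
  s≤s (s≤s (s≤s (subst (suc e ≤_) (≡.sym (+-suc e r)) (s≤s (m≤m+n e r)))))
3+e<3+i+e+r (suc i) e r       _  = s≤s (s≤s (s≤s (s≤s (≤-trans (m≤n+m e i) (m≤m+n (i + e) r)))))

-- Δ-convex sets and cycles

module _ {G : Graph n} {T : Subset n} (convex : ΔConvex G T) where

  AbsorbsCycles : ℕ → Set
  AbsorbsCycles L = (C : Cycle′ G L) → let open Cycle′ C in
    vtx 0 ∈ T → vtx (L ∸ 1) ∈ T → ∀ {p} → p < L → vtx p ∈ T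

  absorbs-≤3 : ∀ {L} → L ≤ 3 → AbsorbsCycles L
  absorbs-≤3     _ C c₀∈T _    {zero} _ = c₀∈T
  absorbs-≤3 {2} _ C _    cₗ∈T {1}    _ = cₗ∈T
  absorbs-≤3 {3} _ C c₀∈T c₂∈T {1}    _ =
    convex _ (inj₂ (_ , _ , c₀∈T , c₂∈T , sym G closes ,
                    sym G (edges 0 (s≤s (s≤s z≤n))) , edges 1 ≤-refl))
    where open Cycle′ C
  absorbs-≤3 {3} _ C _    cₗ∈T {2}    _ = cₗ∈T
  absorbs-≤3 {1} _ _ _ _ {suc _}             (s≤s ())
  absorbs-≤3 {2} _ _ _ _ {suc (suc _)}       (s≤s (s≤s ()))
  absorbs-≤3 {3} _ _ _ _ {suc (suc (suc _))} (s≤s (s≤s (s≤s ())))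
  absorbs-≤3 {suc (suc (suc (suc _)))} (s≤s (s≤s (s≤s ())))

  absorbs-chord : ∀ i e r → (∀ {L′} → L′ < 3 + i + e + r → AbsorbsCycles L′) →
                  (C : Cycle′ G (3 + i + e + r)) → let open Cycle′ C in
                  Adj G (vtx i) (vtx (2 + i + e)) → ¬ (i ≡ 0 × r ≡ 0) →
                  vtx 0 ∈ T → vtx (2 + i + e + r) ∈ T → ∀ {p} → p < 3 + i + e + r → vtx p ∈ T
  -- The chord joins i and j = 2 + i + e. The bypass 0 … i j … L-1 keeps the closing
  -- edge, so it lies in T and puts i and j in T; then the arc i … j, closed by the
  -- chord, lies in T too.
  absorbs-chord i e r absorbs< C chord ¬closing c₀∈T cₗ∈T = cover
    where
    open Cycle′ C

    bypass-edges : ∀ {k} → suc k < 2 + i + r → Adj G (vtx (skip i e k)) (vtx (skip i e (suc k)))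
    bypass-edges {k} k< with k ≟ℕ i
    ... | yes refl =
      subst₂ (λ a b → Adj G (vtx a) (vtx b)) (≡.sym (skip-≤ ≤-refl)) (≡.sym (skip-jump i e)) chord
    ... | no k≢i   = subst (λ b → Adj G (vtx (skip i e k)) (vtx b)) (≡.sym (skip-suc k≢i))
                       (edges (skip i e k) (subst (_< 3 + i + e + r) (skip-suc k≢i) (skip-< i e r k<)))

    bypass : Cycle′ G (2 + i + r)
    bypass = subcycle G C (skip i e) (skip-< i e r) skip-injective bypass-edges
               (subst (λ a → Adj G (vtx a) (vtx 0)) (≡.sym (skip-after i e r)) closes)

    bypass⊆T : ∀ {k} → k < 2 + i + r → vtx (skip i e k) ∈ T
    bypass⊆T = absorbs< (s≤s (s≤s (s≤s (+-monoˡ-≤ r (m≤m+n i e))))) bypass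
                 c₀∈T (subst (λ a → vtx a ∈ T) (≡.sym (skip-after i e r)) cₗ∈T)

    1+i<2+i+r : suc i < 2 + i + r
    1+i<2+i+r = s≤s (s≤s (m≤m+n i r))

    i<2+i+r : i < 2 + i + r
    i<2+i+r = <-trans (n<1+n i) 1+i<2+i+r

    cᵢ∈T : vtx i ∈ T
    cᵢ∈T = subst (λ a → vtx a ∈ T) (skip-≤ ≤-refl) (bypass⊆T i<2+i+r)

    cⱼ∈T : vtx (2 + i + e) ∈ T
    cⱼ∈T = subst (λ a → vtx a ∈ T) (skip-jump i e) (bypass⊆T 1+i<2+i+r)

    arc-< : ∀ {k} → k < 3 + e → i + k < 3 + i + e + r
    arc-< {k} k< = begin-strict
      i + k              <⟨ +-monoʳ-< i k< ⟩
      i + (3 + e)        ≡⟨ +-suc i (2 + e) ⟩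
      suc (i + (2 + e))  ≡⟨ cong suc (m+[2+n]≡2+m+n i e) ⟩
      3 + i + e          ≤⟨ m≤m+n (3 + i + e) r ⟩
      3 + i + e + r      ∎
      where open ≤-Reasoning

    arc : Cycle′ G (3 + e)
    arc = subcycle G C (i +_) arc-< (+-cancelˡ-≡ i _ _)
            (λ {k} k< → subst (λ b → Adj G (vtx (i + k)) (vtx b)) (≡.sym (+-suc i k))
                          (edges (i + k) (subst (_< 3 + i + e + r) (+-suc i k) (arc-< k<))))
            (subst₂ (λ a b → Adj G (vtx a) (vtx b)) (≡.sym (m+[2+n]≡2+m+n i e)) (≡.sym (+-identityʳ i))
              (sym G chord))

    arc⊆T : ∀ {k} → k < 3 + e → vtx (i + k) ∈ T
    arc⊆T = absorbs< (3+e<3+i+e+r i e r ¬closing) arc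
              (subst (λ a → vtx a ∈ T) (≡.sym (+-identityʳ i)) cᵢ∈T)
              (subst (λ a → vtx a ∈ T) (≡.sym (m+[2+n]≡2+m+n i e)) cⱼ∈T)

    cover : ∀ {p} → p < 3 + i + e + r → vtx p ∈ T
    cover {p} p< with p ≤? i | 2 + i + e ≤? p
    ... | yes p≤i | _ = subst (λ a → vtx a ∈ T) (skip-≤ p≤i) (bypass⊆T (≤-<-trans p≤i i<2+i+r))
    ... | no p≰i | yes j≤p with m≤n⇒∃[o]m+o≡n j≤p
    ...   | t , refl = subst (λ a → vtx a ∈ T) (skip-after i e t)
                         (bypass⊆T (s≤s (s≤s (+-monoʳ-≤ i t≤r))))
      where
      t≤r : t ≤ r
      t≤r = +-cancelˡ-≤ (i + e) t r (≤-pred (≤-pred (≤-pred p<)))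
    cover {p} p< | no p≰i | no j≰p with m≤n⇒∃[o]m+o≡n (<⇒≤ (≰⇒> p≰i))
    ...   | k , refl = arc⊆T (m<n⇒m<1+n (+-cancelˡ-< i k (2 + e)
                         (<-≤-trans (≰⇒> j≰p) (≤-reflexive (≡.sym (m+[2+n]≡2+m+n i e))))))

  absorbsCycles : Chordal G → ∀ L → AbsorbsCycles L
  absorbsCycles chordal = <-rec AbsorbsCycles absorbs
    where
    absorbs : ∀ L → (∀ {L′} → L′ < L → AbsorbsCycles L′) → AbsorbsCycles L
    absorbs L absorbs< C with 4 ≤? L
    ... | no 4≰L = absorbs-≤3 (≤-pred (≰⇒> 4≰L)) C
    ... | yes 4≤L with chordal L (toCycle G 4≤L C)
    ...   | i , j , 2+i≤j , j<L , notEnds , chord with m≤n⇒∃[o]m+o≡n 2+i≤j | m≤n⇒∃[o]m+o≡n j<L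
    ...     | e , refl | r , refl = absorbs-chord i e r absorbs< C chord ¬closing
      where
      ¬closing : ¬ (i ≡ 0 × r ≡ 0)
      ¬closing (refl , refl) = notEnds (refl , cong (2 +_) (≡.sym (+-identityʳ e)))

adj⇒≢ : (G : Graph n) {u v : Fin n} → Adj G u v → v ≢ u
adj⇒≢ G uv refl = irrefl G uv

module _ {G : Graph n} (2-connected : TwoConnected G) (chordal : Chordal G)
         {T : Subset n} (convex : ΔConvex G T) where

  neighbour∈convex : ∀ {a b w} → a ∈ T → b ∈ T → Adj G a b → Adj G a w → w ∈ T
  neighbour∈convex {a} {b} {w} a∈T b∈T ab aw
    with loopErase (proj₂ (proj₂ 2-connected) a w b (adj⇒≢ G aw) (adj⇒≢ G ab))
  ... | s , U =
    absorbsCycles convex chordal _ (reach⇒cycle G a⇝b (All.map ≢-sym (vertices-All a⇝b) ∷ U) (sym G ab))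
      a∈T (subst (_∈ T) (≡.sym (vertex-last s)) b∈T) (s≤s (s≤s z≤n))
    where
    a⇝b : Reach G (_≢ a) a b
    a⇝b = step aw (adj⇒≢ G aw) s

  reach⊆convex : ∀ {Q u b v} → u ∈ T → b ∈ T → Adj G u b → Reach G Q u v → v ∈ T
  reach⊆convex u∈T _   _  here          = u∈T
  reach⊆convex u∈T b∈T ub (step uv _ r) =
    reach⊆convex (neighbour∈convex u∈T b∈T ub uv) u∈T (sym G uv) r

  convex∋edge⇒full : ∀ {x y} → x ∈ T → y ∈ T → Adj G x y → ∀ v → v ∈ T
  convex∋edge⇒full {x} x∈T y∈T xy v = reach⊆convex x∈T y∈T xy (proj₁ (proj₂ 2-connected) x v)

-- Convex independence

module _ (G : Graph n) where

  independent⇒convex : ∀ {S} → Independent G S → ΔConvex G S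
  independent⇒convex _   _ (inj₁ v∈S)                      = v∈S
  independent⇒convex ind _ (inj₂ (x , y , x∈S , y∈S , xy , _)) = ⊥-elim (ind x y x∈S y∈S xy)

  independent-removals⇒ci : ∀ {S} → (∀ b → b ∈ S → Independent G (S - b)) → ConvexlyIndependent G S
  independent-removals⇒ci {S} ind b b∈S b∈hull =
    x∈p─q⇒x∉q (b∈hull (S - b) (λ x∈ → x∈) (independent⇒convex (ind b b∈S))) (x∈⁅x⁆ b)

  independent⇒ci : ∀ {S} → Independent G S → ConvexlyIndependent G S
  independent⇒ci {S} ind = independent-removals⇒ci λ b _ x y x∈ y∈ →
    ind x y (p─q⊆p S ⁅ b ⁆ x∈) (p─q⊆p S ⁅ b ⁆ y∈)

  ci⇒independent : TwoConnected G → Chordal G →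
                   ∀ {S} → 3 ≤ ∣ S ∣ → ConvexlyIndependent G S → Independent G S
  ci⇒independent 2-connected chordal {S} 3≤∣S∣ ci x y x∈S y∈S xy with ∃-third S x y 3≤∣S∣
  ... | z , z∈S , z≢x , z≢y = ci z z∈S λ T S-z⊆T convex →
    convex∋edge⇒full 2-connected chordal convex
      (S-z⊆T (x∈p∧x≢y⇒x∈p-y x∈S (≢-sym z≢x))) (S-z⊆T (x∈p∧x≢y⇒x∈p-y y∈S (≢-sym z≢y))) xy z

pair : ∀ {m} → Subset (2 + m)
pair = inside ∷ inside ∷ ∅

pair-subsingleton : ∀ {m} {x y b : Fin (2 + m)} →
                    x ∈ pair → y ∈ pair → b ∈ pair → x ≢ b → y ≢ b → x ≡ y
pair-subsingleton here         here         _            _   _   = refl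
pair-subsingleton (there here) (there here) _            _   _   = refl
pair-subsingleton here         (there here) here         x≢b _   = ⊥-elim (x≢b refl)
pair-subsingleton here         (there here) (there here) _   y≢b = ⊥-elim (y≢b refl)
pair-subsingleton (there here) here         here         _   y≢b = ⊥-elim (y≢b refl)
pair-subsingleton (there here) here         (there here) x≢b _   = ⊥-elim (x≢b refl)
pair-subsingleton (there (there x∈∅)) _ _ _ _ = ⊥-elim (∉⊥ x∈∅)
pair-subsingleton _ (there (there y∈∅)) _ _ _ = ⊥-elim (∉⊥ y∈∅)
pair-subsingleton _ _ (there (there b∈∅)) _ _ = ⊥-elim (∉⊥ b∈∅)

∃-pair-ci : (G : Graph n) → 2 ≤ n → ∃[ S ] (ConvexlyIndependent G S × ∣ S ∣ ≡ 2)
∃-pair-ci {suc zero} G (s≤s ())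
∃-pair-ci {suc (suc m)} G _ =
  pair , independent-removals⇒ci G pair-minus-independent , cong (2 +_) (∣⊥∣≡0 m)
  where
  pair-minus-independent : ∀ b → b ∈ pair → Independent G (pair - b)
  pair-minus-independent b b∈ x y x∈ y∈ xy =
    irrefl G (subst (Adj G x) (≡.sym x≡y) xy)
    where
    x≡y : x ≡ y
    x≡y = pair-subsingleton (p─q⊆p pair ⁅ b ⁆ x∈) (p─q⊆p pair ⁅ b ⁆ y∈) b∈ (x∈p-y⇒x≢y x∈) (x∈p-y⇒x≢y y∈)

isRank : (G : Graph n) {d : ℕ} → (∀ S → ConvexlyIndependent G S → ∣ S ∣ ≤ d) →
         ∃[ S ] (ConvexlyIndependent G S × d ≤ ∣ S ∣) → IsRank G d
isRank G bound (S , ci , d≤∣S∣) =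
  (λ S′ ∣S′∣>d ci′ → <⇒≱ ∣S′∣>d (bound S′ ci′)) ,
  (λ m larger⇒dependent → ≮⇒≥ (λ m<d → larger⇒dependent S (<-≤-trans m<d d≤∣S∣) ci))

corollary3 : (n : ℕ) (G : Graph n) → TwoConnected G → Chordal G →
    (a : ℕ) → IsIndependenceNumber G a → IsRank G (2 ⊔ a)
corollary3 n G 2-connected chordal a ((S₀ , S₀-independent , ∣S₀∣≡a) , α-max) = isRank G ci-bound witness
  where
  ci-bound : ∀ S → ConvexlyIndependent G S → ∣ S ∣ ≤ 2 ⊔ a
  ci-bound S ci with 3 ≤? ∣ S ∣
  ... | yes 3≤∣S∣ = ≤-trans (α-max S (ci⇒independent G 2-connected chordal 3≤∣S∣ ci)) (m≤n⊔m 2 a)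
  ... | no  3≰∣S∣ = ≤-trans (≤-pred (≰⇒> 3≰∣S∣)) (m≤m⊔n 2 a)

  witness : ∃[ S ] (ConvexlyIndependent G S × 2 ⊔ a ≤ ∣ S ∣)
  witness with 2 ≤? a | ∃-pair-ci G (≤-trans (n≤1+n 2) (proj₁ 2-connected))
  ... | yes 2≤a | _ = S₀ , independent⇒ci G S₀-independent , ⊔-lub (≤-trans 2≤a a≤∣S₀∣) a≤∣S₀∣
    where
    a≤∣S₀∣ : a ≤ ∣ S₀ ∣
    a≤∣S₀∣ = ≤-reflexive (≡.sym ∣S₀∣≡a)
  ... | no 2≰a | S , ci , ∣S∣≡2 = S , ci , ⊔-lub 2≤∣S∣ (≤-trans (<⇒≤ (≰⇒> 2≰a)) 2≤∣S∣)
    where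
    2≤∣S∣ : 2 ≤ ∣ S ∣
    2≤∣S∣ = ≤-reflexive (≡.sym ∣S∣≡2)
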